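{- Let $\mathbb F$ be a field, let $(G,\psi)$ be an $(\mathbb F^+\rtimes\mathbb F^\times)$-gain graph, and let $D$ and $D'$ be orientations of $G$. Then $A(D',\psi)$ can be obtained from $A(D,\psi)$ by scaling columns by nonzero elements of $\mathbb F$.
   Context: $\mathbb F^+\rtimes\mathbb F^\times$ is the group on $\mathbb F\times\mathbb F^\times$ with $(a,b)\circ(c,d)=(a+bc,bd)$, identity $(0,1)$. A $\Gamma$-gain function on a graph $G$ (loops and parallel edges allowed) maps each oriented edge $(e,u,v)$ ($e$ an edge with ends $u,v$) to $\Gamma$, with $\psi(e,u,v)=\psi(e,v,u)^{ -1}$ for $u\ne v$. An orientation $D$ of $G$ chooses for each edge $e$ one oriented edge $(e,v,w)$ ("$e$ oriented from $v$ to $w$"; for a loop $v=w$). The matrix $A(D,\psi)$ over $\mathbb F$ has rows indexed by $V(G)\cup\{v_0\}$ (with $v_0\notin V(G)$) and columns indexed by $E(G)$: if $e$ is oriented in $D$ from $v$ to $w$ and $\psi(e,v,w)=(a,b)$, then the entry in row $u$, column $e$ is $a$ if $u=v_0$; $1$ if $u=v\ne w$; $-b$ if $u=w\ne v$; $1-b$ if $u=v=w$; and $0$ otherwise. -}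

module Defs where

open import Level using (Level; _⊔_; suc)
open import Algebra.Bundles using (CommutativeRing)
open import Data.Nat using (ℕ)
open import Data.Fin using (Fin)
open import Data.Fin.Properties using (_≟_)
open import Data.Bool using (Bool; true; false)
open import Data.Maybe using (Maybe; just; nothing)
open import Data.Product using (Σ; _×_; _,_; ∃)
open import Relation.Nullary using (¬_; yes; no)
open import Relation.Binary.PropositionalEquality using (_≡_)

record Field (c ℓ : Level) : Set (suc (c ⊔ ℓ)) where
  field
    commutativeRing : CommutativeRing c ℓ
  open CommutativeRing commutativeRing public
  field
    1≉0     : ¬ (1# ≈ 0#)
    inverse : ∀ x → ¬ (x ≈ 0#) → Σ Carrier λ y → x * y ≈ 1#

module _ {c ℓ : Level} (F : Field c ℓ) where
  open Field F

  -- Elements of the group F⁺ ⋊ F^× : pairs (a , b) with b ≠ 0.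
  record Aff : Set (c ⊔ ℓ) where
    constructor aff
    field
      tr : Carrier
      sc : Carrier
      sc≉0 : ¬ (sc ≈ 0#)
  open Aff public

  _∘ᴬ_ : Aff → Aff → Carrier × Carrier
  x ∘ᴬ y = (tr x + sc x * tr y , sc x * sc y)

  IsIdᴬ : Carrier × Carrier → Set ℓ
  IsIdᴬ (a , b) = (a ≈ 0#) × (b ≈ 1#)

  _IsInvOf_ : Aff → Aff → Set ℓ
  x IsInvOf y = IsIdᴬ (x ∘ᴬ y)

  _≈ᴬ_ : Aff → Aff → Set ℓ
  x ≈ᴬ y = (tr x ≈ tr y) × (sc x ≈ sc y)

record Graph : Set where
  field
    nV nE : ℕ
    end₁ end₂ : Fin nE → Fin nV
open Graph public

-- Oriented edges of e are encoded by a Bool: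
--   (e , true)  stands for (e , end₁ e , end₂ e)
--   (e , false) stands for (e , end₂ e , end₁ e)
tail head : (G : Graph) → Fin (nE G) → Bool → Fin (nV G)
tail G e true  = end₁ G e
tail G e false = end₂ G e
head G e true  = end₂ G e
head G e false = end₁ G e

Orientation : Graph → Set
Orientation G = Fin (nE G) → Bool

module _ {c ℓ : Level} (F : Field c ℓ) where
  open Field F

  -- For a non-loop edge the two oriented
  -- edges get mutually inverse gains; for a loop (e , v , v) is a single
  -- oriented edge, so both encodings must carry the same gain.
  record GainFunction (G : Graph) : Set (c ⊔ ℓ) where
    field
      ψ : Fin (nE G) → Bool → Aff F
      inv  : ∀ e → ¬ (end₁ G e ≡ end₂ G e) → _IsInvOf_ F (ψ e true) (ψ e false)
      loop : ∀ e → end₁ G e ≡ end₂ G e → _≈ᴬ_ F (ψ e true) (ψ e false)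
  open GainFunction public

  -- The matrix A(D,ψ); row 'nothing' is v₀, row 'just u' is vertex u.
  incMatrix : (G : Graph) → Orientation G → GainFunction G
            → Maybe (Fin (nV G)) → Fin (nE G) → Carrier
  incMatrix G D Ψ nothing  e = tr (ψ Ψ e (D e))
  incMatrix G D Ψ (just u) e with u ≟ tail G e (D e) | u ≟ head G e (D e)
  ... | yes _ | yes _ = 1# - sc (ψ Ψ e (D e))
  ... | yes _ | no _  = 1#
  ... | no _  | yes _ = - sc (ψ Ψ e (D e))
  ... | no _  | no _  = 0#

{-# OPTIONS --safe #-}
module Submission where

-- Column e of A(D,ψ) depends only on the oriented edge chosen by D. Reversing
-- a non-loop edge replaces its gain (a,b) by the inverse (a′,b′) = (-b′a, 1/b),
-- which multiplies every entry of the column by -b′ ≠ 0: the v₀ entry a becomes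
-- a′, the tail entry 1 becomes -b′, and the head entry -b becomes -b′·-b = 1.
-- A loop has a single oriented edge, so its column does not change at all.

open import Defs
open import Level using (Level; _⊔_)
open import Algebra.Bundles using (Ring)
open import Data.Bool using (Bool; true; false)
open import Data.Empty using (⊥-elim)
open import Data.Fin using (Fin)
open import Data.Fin.Properties using (_≟_)
open import Data.Maybe using (Maybe; just; nothing)
open import Function using (_∘_)
open import Data.Product using (Σ; _×_; _,_; proj₁; proj₂)
open import Relation.Nullary using (¬_; yes; no)
open import Relation.Binary.PropositionalEquality as ≡ using (_≡_)
import Algebra.Properties.Ring as RingProperties
import Relation.Binary.Reasoning.Setoid as SetoidReasoning

module _ {c ℓ : Level} (R : Ring c ℓ) where
  open Ring R
  open RingProperties R
  open SetoidReasoning setoid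

  x≉0⇒-x≉0 : ∀ {x} → ¬ (x ≈ 0#) → ¬ (- x ≈ 0#)
  x≉0⇒-x≉0 x≉0 -x≈0 = x≉0 (-‿injective (trans -x≈0 (sym -0#≈0#)))

  x+y*z≈0⇒x≈-y*z : ∀ x y z → x + y * z ≈ 0# → x ≈ - y * z
  x+y*z≈0⇒x≈-y*z x y z eq = trans (+-inverseˡ-unique x (y * z) eq) (-‿distribˡ-* y z)

  x*y≈1⇒-x*-y≈1 : ∀ x y → x * y ≈ 1# → - x * - y ≈ 1#
  x*y≈1⇒-x*-y≈1 x y eq = begin
    - x * - y      ≈⟨ -‿distribˡ-* x (- y) ⟨
    - (x * - y)    ≈⟨ -‿cong (-‿distribʳ-* x y) ⟨
    - (- (x * y))  ≈⟨ -‿involutive (x * y) ⟩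
    x * y          ≈⟨ eq ⟩
    1#             ∎

module _ {c ℓ : Level} (F : Field c ℓ) where
  open Field F
  open RingProperties ring using (+-inverseˡ-unique; -‿distribʳ-*)
  open SetoidReasoning setoid

  IsInvOf-sym : ∀ {x y} → _IsInvOf_ F x y → _IsInvOf_ F y x
  IsInvOf-sym {aff a b _} {aff a′ b′ _} (a+ba′≈0 , bb′≈1) = a′+b′a≈0 , trans (*-comm b′ b) bb′≈1
    where
    a′+b′a≈0 : a′ + b′ * a ≈ 0#
    a′+b′a≈0 = begin
      a′ + b′ * a             ≈⟨ +-congˡ (*-congˡ (+-inverseˡ-unique a (b * a′) a+ba′≈0)) ⟩
      a′ + b′ * - (b * a′)    ≈⟨ +-congˡ (-‿distribʳ-* b′ (b * a′)) ⟨
      a′ + - (b′ * (b * a′))  ≈⟨ +-congˡ (-‿cong (*-assoc b′ b a′)) ⟨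
      a′ + - (b′ * b * a′)    ≈⟨ +-congˡ (-‿cong (*-congʳ (trans (*-comm b′ b) bb′≈1))) ⟩
      a′ + - (1# * a′)        ≈⟨ +-congˡ (-‿cong (*-identityˡ a′)) ⟩
      a′ + - a′               ≈⟨ -‿inverseʳ a′ ⟩
      0#                      ∎

  ≈ᴬ-sym : ∀ {x y} → _≈ᴬ_ F x y → _≈ᴬ_ F y x
  ≈ᴬ-sym (tr≈ , sc≈) = sym tr≈ , sym sc≈

  NonzeroMultiple : {I : Set} → (I → Carrier) → (I → Carrier) → Set (c ⊔ ℓ)
  NonzeroMultiple x′ x = Σ Carrier λ s → ¬ (s ≈ 0#) × (∀ i → x′ i ≈ s * x i)

  ≈⇒NonzeroMultiple : {I : Set} {x′ x : I → Carrier} → (∀ i → x′ i ≈ x i) → NonzeroMultiple x′ x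
  ≈⇒NonzeroMultiple x′≈x = 1# , 1≉0 , λ i → trans (x′≈x i) (sym (*-identityˡ _))

  edgeColumn : ∀ {n} → Fin n → Fin n → Aff F → Maybe (Fin n) → Carrier
  edgeColumn v w g nothing = tr g
  edgeColumn v w g (just u) with u ≟ v | u ≟ w
  ... | yes _ | yes _ = 1# - sc g
  ... | yes _ | no _  = 1#
  ... | no _  | yes _ = - sc g
  ... | no _  | no _  = 0#

  edgeColumn-cong : ∀ {n} {v w : Fin n} {g g′} → _≈ᴬ_ F g g′ →
                    ∀ u → edgeColumn v w g u ≈ edgeColumn v w g′ u
  edgeColumn-cong (tr≈ , sc≈) nothing = tr≈
  edgeColumn-cong {v = v} {w} (tr≈ , sc≈) (just u) with u ≟ v | u ≟ w
  ... | yes _ | yes _ = +-congˡ (-‿cong sc≈)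
  ... | yes _ | no _  = refl
  ... | no _  | yes _ = -‿cong sc≈
  ... | no _  | no _  = refl

  edgeColumn-loop : ∀ {n} {v w : Fin n} {g g′} → v ≡ w → _≈ᴬ_ F g′ g →
                    ∀ u → edgeColumn w v g′ u ≈ edgeColumn v w g u
  edgeColumn-loop ≡.refl g′≈g = edgeColumn-cong g′≈g

  edgeColumn-reverse : ∀ {n} {v w : Fin n} {g g′} → ¬ (v ≡ w) → _IsInvOf_ F g′ g →
                       NonzeroMultiple (edgeColumn w v g′) (edgeColumn v w g)
  edgeColumn-reverse {v = v} {w} {g} {g′} v≢w (a′+b′a≈0 , b′b≈1) =
    - sc g′ , x≉0⇒-x≉0 ring (sc≉0 g′) , reversed
    where
    reversed : ∀ u → edgeColumn w v g′ u ≈ - sc g′ * edgeColumn v w g u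
    reversed nothing = x+y*z≈0⇒x≈-y*z ring (tr g′) (sc g′) (tr g) a′+b′a≈0
    reversed (just u) with u ≟ v | u ≟ w
    ... | yes u≡v | yes u≡w = ⊥-elim (v≢w (≡.trans (≡.sym u≡v) u≡w))
    ... | yes _   | no _    = sym (*-identityʳ _)
    ... | no _    | yes _   = sym (x*y≈1⇒-x*-y≈1 ring (sc g′) (sc g) b′b≈1)
    ... | no _    | no _    = sym (zeroʳ _)

module _ {c ℓ : Level} (F : Field c ℓ) (G : Graph) (Ψ : GainFunction F G) where
  open Field F

  orientedColumn : Fin (nE G) → Bool → Maybe (Fin (nV G)) → Carrier
  orientedColumn e b = edgeColumn F (tail G e b) (head G e b) (ψ Ψ e b)

  incMatrix≡orientedColumn : ∀ D u e → incMatrix F G D Ψ u e ≡ orientedColumn e (D e) u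
  incMatrix≡orientedColumn D nothing e = ≡.refl
  incMatrix≡orientedColumn D (just u) e with u ≟ tail G e (D e) | u ≟ head G e (D e)
  ... | yes _ | yes _ = ≡.refl
  ... | yes _ | no _  = ≡.refl
  ... | no _  | yes _ = ≡.refl
  ... | no _  | no _  = ≡.refl

  orientedColumn-reorient : ∀ e b b′ → NonzeroMultiple F (orientedColumn e b′) (orientedColumn e b)
  orientedColumn-reorient e true  true  = ≈⇒NonzeroMultiple F (λ _ → refl)
  orientedColumn-reorient e false false = ≈⇒NonzeroMultiple F (λ _ → refl)
  orientedColumn-reorient e true  false with end₁ G e ≟ end₂ G e
  ... | yes isLoop =
    ≈⇒NonzeroMultiple F (edgeColumn-loop F isLoop (≈ᴬ-sym F {ψ Ψ e true} {ψ Ψ e false} (loop Ψ e isLoop)))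
  ... | no notLoop =
    edgeColumn-reverse F notLoop (IsInvOf-sym F {ψ Ψ e true} {ψ Ψ e false} (inv Ψ e notLoop))
  orientedColumn-reorient e false true  with end₁ G e ≟ end₂ G e
  ... | yes isLoop = ≈⇒NonzeroMultiple F (edgeColumn-loop F (≡.sym isLoop) (loop Ψ e isLoop))
  ... | no notLoop = edgeColumn-reverse F (notLoop ∘ ≡.sym) (inv Ψ e notLoop)

lemma5p4 : {c ℓ : Level} (F : Field c ℓ) (G : Graph) (Ψ : GainFunction F G)
           (D D' : Orientation G) →
           Σ (Fin (nE G) → Field.Carrier F) λ s →
             ((e : Fin (nE G)) → ¬ (Field._≈_ F (s e) (Field.0# F))) ×
             ((u : Maybe (Fin (nV G))) (e : Fin (nE G)) →
               Field._≈_ F (incMatrix F G D' Ψ u e) (Field._*_ F (s e) (incMatrix F G D Ψ u e)))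
lemma5p4 F G Ψ D D′ = scale , scale≉0 , rescales
  where
  open Field F
  open SetoidReasoning setoid

  reorient : ∀ e → NonzeroMultiple F (orientedColumn F G Ψ e (D′ e)) (orientedColumn F G Ψ e (D e))
  reorient e = orientedColumn-reorient F G Ψ e (D e) (D′ e)

  scale : Fin (nE G) → Carrier
  scale e = proj₁ (reorient e)

  scale≉0 : ∀ e → ¬ (scale e ≈ 0#)
  scale≉0 e = proj₁ (proj₂ (reorient e))

  rescales : ∀ u e → incMatrix F G D′ Ψ u e ≈ scale e * incMatrix F G D Ψ u e
  rescales u e = begin
    incMatrix F G D′ Ψ u e                    ≡⟨ incMatrix≡orientedColumn F G Ψ D′ u e ⟩
    orientedColumn F G Ψ e (D′ e) u           ≈⟨ proj₂ (proj₂ (reorient e)) u ⟩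
    scale e * orientedColumn F G Ψ e (D e) u  ≡⟨ ≡.cong (scale e *_) (incMatrix≡orientedColumn F G Ψ D u e) ⟨
    scale e * incMatrix F G D Ψ u e           ∎
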